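{- A finite relational structure $\mathcal H$ is strongly 2-rectangular if and only if it is strongly 2-balanced.
   Context: The 2-modular quantifier $\exists^{\equiv2}\mathbf y\,\Phi(\mathbf x,\mathbf y)$ holds at $\mathbf a$ iff the number of $\mathbf b$ with $\Phi(\mathbf a,\mathbf b)$ is odd. A relation is 2-mpp-definable in $\mathcal H$ if it is defined by a formula $\exists^{\equiv2}Y_1\cdots\exists^{\equiv2}Y_m\Phi$ with $\Phi$ a conjunction of atomic formulas using relations of $\mathcal H$ and equality; $\langle\mathcal H\rangle_2$ is the set of all such relations. An $n$-ary relation $\mathcal R$ ($n\ge2$) is rectangular if for every nonempty $I\subsetneq[n]$, viewing $\mathcal R$ as a binary relation between $\mathrm{pr}_I\mathcal R$ and $\mathrm{pr}_{[n]\setminus I}\mathcal R$, $(a,c),(a,d),(b,c)\in\mathcal R$ imply $(b,d)\in\mathcal R$. $\mathcal H$ is strongly 2-rectangular if every relation of $\langle\mathcal H\rangle_2$ of arity at least 2 is rectangular. A matrix is a rank-1 block matrix if, after permuting rows and columns, it is block-diagonal (blocks not necessarily square) with every nonzero block of rank at most 1. A ternary relation $\mathcal R\subseteq A_1\times A_2\times A_3$ is 2-balanced if the matrix $M_{\mathcal R}$ over $\mathbb Z_2$ with rows indexed by $A_1$, columns by $A_2$, and $M_{\mathcal R}[x,y]\equiv|\{z\in A_3:(x,y,z)\in\mathcal R\}|\pmod 2$ is a rank-1 block matrix (rank over $\mathbb Z_2$). A relation of arity $n>3$ on $H$ is 2-balanced if every representation of it as a ternary relation $\subseteq H^k\times H^\ell\times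 H^{n-k-\ell}$ is 2-balanced. $\mathcal H$ is strongly 2-balanced if every relation in $\langle\mathcal H\rangle_2$ (of arity at least 3) is 2-balanced. -}

module Defs where

open import Data.Nat using (ℕ; zero; suc; _+_; _≤_; _%_; _≡ᵇ_)
open import Data.Fin using (Fin; _≟_)
open import Relation.Nullary.Decidable using (⌊_⌋)
open import Data.Bool using (Bool; true; false; if_then_else_; _∧_)
open import Data.List using (List; []; _∷_; concatMap; map)
open import Data.Bool.ListAction using (and)
open import Data.Nat.ListAction using (sum)
open import Data.List.Base using () renaming (allFin to allFinL)
open import Data.Vec using (Vec; []; _∷_; _++_; lookup; tabulate)
open import Data.Sum using (_⊎_; inj₁; inj₂; [_,_])
open import Data.Product using (Σ; ∃; _×_; _,_)
open import Relation.Binary.PropositionalEquality using (_≡_; subst)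

record Structure (N : ℕ) : Set where
  field
    r   : ℕ
    ar  : Fin r → ℕ
    rel : (i : Fin r) → Vec (Fin N) (ar i) → Bool

open Structure public

Rel : ℕ → ℕ → Set
Rel N n = Vec (Fin N) n → Bool

allVecs : (N k : ℕ) → List (Vec (Fin N) k)
allVecs N zero    = [] ∷ []
allVecs N (suc k) = concatMap (λ i → map (i ∷_) (allVecs N k)) (allFinL N)

count : {A : Set} → (A → Bool) → List A → ℕ
count f []       = 0
count f (x ∷ xs) = if f x then suc (count f xs) else count f xs

isOdd : ℕ → Bool
isOdd n = (n % 2) ≡ᵇ 1

-- 2-mpp formulas  ∃^{≡2}Y₁ ⋯ ∃^{≡2}Yₘ Φ  with n free variables,
-- block sizes ks = (|Y₁|, …, |Yₘ|); variables are  Fin n ⊎ Fin (sum ks)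
-- (free variables, resp. bound variables listed block by block).

data Atom {N : ℕ} (S : Structure N) (V : Set) : Set where
  relAtom : (i : Fin (r S)) → Vec V (ar S i) → Atom S V
  eqAtom  : V → V → Atom S V

val : {N n m : ℕ} → Vec (Fin N) n → Vec (Fin N) m → Fin n ⊎ Fin m → Fin N
val a b = [ lookup a , lookup b ]

module _ {N : ℕ} (S : Structure N) where

  evalAtom : {n m : ℕ} → Vec (Fin N) n → Vec (Fin N) m →
             Atom S (Fin n ⊎ Fin m) → Bool
  evalAtom a b (relAtom i vs) = rel S i (Data.Vec.map (val a b) vs)
  evalAtom a b (eqAtom u v) = ⌊ val a b u ≟ val a b v ⌋

  evalConj : {n m : ℕ} → List (Atom S (Fin n ⊎ Fin m)) →
             Vec (Fin N) n → Vec (Fin N) m → Bool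
  evalConj Φ a b = and (map (evalAtom a b) Φ)

  -- nested 2-modular quantifiers; the first block is outermost.
  -- Q receives the bound assignment and the free assignment.
  evalQ : {n : ℕ} (ks : List ℕ) →
          (Vec (Fin N) (sum ks) → Vec (Fin N) n → Bool) →
          Vec (Fin N) n → Bool
  evalQ []       Q a = Q [] a
  evalQ (k ∷ ks) Q a =
    isOdd (count (λ b₁ → evalQ ks (λ b' → Q (b₁ ++ b')) a) (allVecs N k))

  Definable₂ : {n : ℕ} → Rel N n → Set
  Definable₂ {n} R =
    Σ (List ℕ) λ ks →
    Σ (List (Atom S (Fin n ⊎ Fin (sum ks)))) λ Φ →
      (a : Vec (Fin N) n) → R a ≡ evalQ ks (λ b a' → evalConj Φ a' b) a

-- Rectangularity.  A subset I ⊆ [n] is a function Fin n → Bool; the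
-- tuple  merge I u v  has the I-coordinates of u and the others of v,
-- i.e. it is the pair (pr_I u , pr_{[n]∖I} v).

merge : {N n : ℕ} → (Fin n → Bool) → Vec (Fin N) n → Vec (Fin N) n →
        Vec (Fin N) n
merge I u v = tabulate λ j → if I j then lookup u j else lookup v j

Rectangular : {N n : ℕ} → Rel N n → Set
Rectangular {N} {n} R =
  (I : Fin n → Bool) →
  ∃ (λ j → I j ≡ true) →
  ∃ (λ j → I j ≡ false) →
  (u v w z : Vec (Fin N) n) →
  R (merge I u w) ≡ true →
  R (merge I u z) ≡ true →
  R (merge I v w) ≡ true →
  R (merge I v z) ≡ true

-- rank ≤ 1 over ℤ₂ of the submatrix on rows P, columns Q:
-- its row space is spanned by a single vector v, i.e. every row is 0 or v.
RankAtMost1 : {A B : Set} → (A → B → Bool) → (A → Set) → (B → Set) → Set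
RankAtMost1 {A} {B} M P Q =
  Σ (B → Bool) λ v → (x : A) → P x →
    ((y : B) → Q y → M x y ≡ false) ⊎ ((y : B) → Q y → M x y ≡ v y)

-- after permuting rows/columns, block diagonal with t blocks (rows of
-- block i: rb x ≡ i, columns of block i: cb y ≡ i; blocks may be empty
-- or non-square), zero outside the blocks, every block of rank ≤ 1.
RankOneBlock : {A B : Set} → (A → B → Bool) → Set
RankOneBlock {A} {B} M =
  Σ ℕ λ t → Σ (A → Fin t) λ rb → Σ (B → Fin t) λ cb →
    ((x : A) (y : B) → M x y ≡ true → rb x ≡ cb y) ×
    ((i : Fin t) → RankAtMost1 M (λ x → rb x ≡ i) (λ y → cb y ≡ i))

Balanced₂ : {N n : ℕ} → Rel N n → Set
Balanced₂ {N} {n} R =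
  (k ℓ m : ℕ) → 1 ≤ k → 1 ≤ ℓ → 1 ≤ m → (eq : k + (ℓ + m) ≡ n) →
  RankOneBlock {Vec (Fin N) k} {Vec (Fin N) ℓ}
    (λ x y → isOdd (count (λ z → R (subst (Vec (Fin N)) eq (x ++ (y ++ z))))
                          (allVecs N m)))

StronglyRectangular₂ : {N : ℕ} → Structure N → Set
StronglyRectangular₂ {N} S =
  (n : ℕ) → 2 ≤ n → (R : Rel N n) → Definable₂ S R → Rectangular R

StronglyBalanced₂ : {N : ℕ} → Structure N → Set
StronglyBalanced₂ {N} S =
  (n : ℕ) → 3 ≤ n → (R : Rel N n) → Definable₂ S R → Balanced₂ R

-- Over ℤ₂ a 0/1 matrix is a rank-1 block matrix exactly when its support is
-- rectangular: nonzero rows sharing a nonzero column are then equal, and the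
-- classes of such rows are the blocks. Both directions of the theorem thus
-- compare rectangularity of relations with rectangularity of parity matrices,
-- using that ⟨H⟩₂ is closed under 2-mpp definitions. Summing out the last block
-- of a definable R ⊆ H^k × H^ℓ × H^m gives a definable relation on H^k × H^ℓ
-- whose indicator matrix is M_R. Conversely, for definable R and I ⊆ [n] the
-- definable relation R(merge_I x y) ∧ z = x_j has parity matrix R ∘ merge_I
-- in its (n, n, 1) representation.
module Submission where

open import Defs
open import Data.Nat using (ℕ; zero; suc; _+_; _≤_; z≤n; s≤s)
open import Data.Product using (_×_; ∃; _,_; proj₁; proj₂)
open import Data.Bool using (Bool; true; false; if_then_else_; _∧_; _∨_)
open import Data.Bool.ListAction using (any)
open import Data.Bool.Properties
  using (∧-assoc; ∧-comm; ∧-identityʳ; ∧-zeroʳ; ∧-conicalˡ; ∧-conicalʳ; ∨-zeroʳ; not-¬)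
open import Data.Empty using (⊥-elim)
open import Data.Fin using (Fin; zero; suc; _↑ˡ_; _↑ʳ_; _≟_; splitAt)
open import Data.Fin.Properties using (splitAt-↑ʳ)
open import Data.List using (List; []; _∷_; map; concatMap; length; findIndexᵇ; allFin)
  renaming (_++_ to _++ᴸ_; lookup to lookupᴸ; tabulate to tabulateᴸ)
open import Data.List.Properties using (map-tabulate)
open import Data.List.Membership.Propositional using (_∈_)
open import Data.List.Membership.Propositional.Properties using (∈-map⁺; ∈-concat⁺′; ∈-allFin)
open import Data.List.Relation.Unary.Any using (here; there)
open import Data.Maybe using (just; nothing; maybe′)
open import Data.Nat.ListAction using (sum)
open import Data.Nat.Properties using (≤-trans; +-mono-≤; m≤n+m)
open import Data.Sum using (_⊎_; inj₁; inj₂; [_,_]′; map₂)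
open import Data.Vec using (Vec; []; _∷_; _++_; lookup; tabulate; [_])
import Data.Vec as Vec
open import Data.Vec.Properties
  using (map-∘; map-cong; lookup-++ˡ; lookup-++ʳ; lookup-splitAt; lookup∘tabulate; tabulate-cong; tabulate∘lookup)
open import Function using (_∘_; id; const)
open import Relation.Binary.PropositionalEquality
  using (_≡_; refl; sym; trans; cong; cong₂; module ≡-Reasoning)
open import Relation.Nullary.Decidable using (⌊_⌋; ⌊⌋-map′)

private
  variable
    A B : Set
    N k ℓ m : ℕ

count-cong : {f g : A → Bool} → (∀ x → f x ≡ g x) → ∀ xs → count f xs ≡ count g xs
count-cong f≗g [] = refl
count-cong {g = g} f≗g (x ∷ xs) rewrite f≗g x with g x
... | true  = cong suc (count-cong f≗g xs)
... | false = count-cong f≗g xs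

count-false : {f : A → Bool} → (∀ x → f x ≡ false) → ∀ xs → count f xs ≡ 0
count-false f≡false [] = refl
count-false f≡false (x ∷ xs) rewrite f≡false x = count-false f≡false xs

count-map : (f : B → Bool) (g : A → B) (xs : List A) → count f (map g xs) ≡ count (f ∘ g) xs
count-map f g []       = refl
count-map f g (x ∷ xs) with f (g x)
... | true  = cong suc (count-map f g xs)
... | false = count-map f g xs

isOdd-count-∧ʳ : (f : A → Bool) (c : Bool) (xs : List A) →
                 isOdd (count (λ x → f x ∧ c) xs) ≡ isOdd (count f xs) ∧ c
isOdd-count-∧ʳ f true  xs = trans (cong isOdd (count-cong (∧-identityʳ ∘ f) xs)) (sym (∧-identityʳ _))
isOdd-count-∧ʳ f false xs = trans (cong isOdd (count-false (∧-zeroʳ ∘ f) xs)) (sym (∧-zeroʳ _))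

count-tabulate-suc : (f : Fin (suc N) → Bool) → count f (tabulateᴸ suc) ≡ count (f ∘ suc) (allFin N)
count-tabulate-suc {N} f = trans (cong (count f) (sym (map-tabulate id suc))) (count-map f suc (allFin N))

count-≟-allFin : (t : Fin N) → count (λ i → ⌊ i ≟ t ⌋) (allFin N) ≡ 1
count-≟-allFin {suc N} zero    = cong suc (trans (count-tabulate-suc {N} _) (count-false (λ _ → refl) (allFin N)))
count-≟-allFin {suc N} (suc t) = trans (count-tabulate-suc {N} _)
  (trans (count-cong (λ i → ⌊⌋-map′ _ _ (i ≟ t)) (allFin N)) (count-≟-allFin t))

∈-allVecs : ∀ N k (v : Vec (Fin N) k) → v ∈ allVecs N k
∈-allVecs N zero    []      = here refl
∈-allVecs N (suc k) (i ∷ v) =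
  ∈-concat⁺′ (∈-map⁺ (i ∷_) (∈-allVecs N k v)) (∈-map⁺ (λ i → map (i ∷_) (allVecs N k)) (∈-allFin i))

isOdd-count-allVecs₀ : (f : Vec (Fin N) 0 → Bool) → isOdd (count f (allVecs N 0)) ≡ f []
isOdd-count-allVecs₀ f with f []
... | true  = refl
... | false = refl

count-allVecs₁ : (f : Vec (Fin N) 1 → Bool) → count f (allVecs N 1) ≡ count (f ∘ [_]) (allFin N)
count-allVecs₁ {N} f = go (allFin N)
  where
  go : ∀ is → count f (concatMap (λ i → map (i ∷_) ([] ∷ [])) is) ≡ count (f ∘ [_]) is
  go []       = refl
  go (i ∷ is) with f [ i ]
  ... | true  = cong suc (go is)
  ... | false = go is

findIndexᵇ-just : (p : A → Bool) (xs : List A) {i : Fin (length xs)} →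
                  findIndexᵇ p xs ≡ just i → p (lookupᴸ xs i) ≡ true
findIndexᵇ-just p (x ∷ xs) found with p x in px | findIndexᵇ p xs in found′
findIndexᵇ-just p (x ∷ xs) refl | true  | _      = px
findIndexᵇ-just p (x ∷ xs) refl | false | just i = findIndexᵇ-just p xs found′

findIndexᵇ-nothing : (p : A → Bool) (xs : List A) →
                     findIndexᵇ p xs ≡ nothing → ∀ {x} → x ∈ xs → p x ≡ false
findIndexᵇ-nothing p (x ∷ xs) found x∈ with p x in px | findIndexᵇ p xs in found′
findIndexᵇ-nothing p (x ∷ xs) refl (here refl) | false | nothing = px
findIndexᵇ-nothing p (x ∷ xs) refl (there x∈)  | false | nothing = findIndexᵇ-nothing p xs found′ x∈

findIndexᵇ-cong : {p q : A → Bool} → (∀ x → p x ≡ q x) → ∀ xs → findIndexᵇ p xs ≡ findIndexᵇ q xs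
findIndexᵇ-cong p≗q [] = refl
findIndexᵇ-cong p≗q (x ∷ xs) rewrite p≗q x | findIndexᵇ-cong p≗q xs = refl

any-∈ : (p : A → Bool) {xs : List A} {x : A} → x ∈ xs → p x ≡ true → any p xs ≡ true
any-∈ p (here refl) px rewrite px = refl
any-∈ p {x′ ∷ _} (there x∈) px rewrite any-∈ p x∈ px = ∨-zeroʳ (p x′)

any-witness : (p : A → Bool) (xs : List A) → any p xs ≡ true → ∃ λ x → p x ≡ true
any-witness p (x ∷ xs) some with p x in px
... | true  = x , px
... | false = any-witness p xs some

any-cong : {p q : A → Bool} → (∀ x → p x ≡ q x) → ∀ xs → any p xs ≡ any q xs
any-cong p≗q []       = refl
any-cong p≗q (x ∷ xs) = cong₂ _∨_ (p≗q x) (any-cong p≗q xs)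

RectangularMatrix : (A → B → Bool) → Set
RectangularMatrix M = ∀ x x′ y y′ → M x y ≡ true → M x y′ ≡ true → M x′ y ≡ true → M x′ y′ ≡ true

RectangularMatrix-cong : {M M′ : A → B → Bool} → (∀ x y → M x y ≡ M′ x y) →
                         RectangularMatrix M → RectangularMatrix M′
RectangularMatrix-cong M≗M′ rect x x′ y y′ xy xy′ x′y =
  trans (sym (M≗M′ x′ y′))
        (rect x x′ y y′ (trans (M≗M′ x y) xy) (trans (M≗M′ x y′) xy′) (trans (M≗M′ x′ y) x′y))

rankOneBlock⇒rectangular : (M : A → B → Bool) → RankOneBlock M → RectangularMatrix M
rankOneBlock⇒rectangular {B = B} M (t , rb , cb , diagonal , rank≤1) x x′ y y′ xy xy′ x′y =
  trans (row-is-v x′ x′-in-block y y-in-block x′y y′ y′-in-block)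
        (trans (sym (row-is-v x refl y y-in-block xy y′ y′-in-block)) xy′)
  where
  v : B → Bool
  v = proj₁ (rank≤1 (rb x))

  y-in-block : cb y ≡ rb x
  y-in-block = sym (diagonal x y xy)

  y′-in-block : cb y′ ≡ rb x
  y′-in-block = sym (diagonal x y′ xy′)

  x′-in-block : rb x′ ≡ rb x
  x′-in-block = trans (diagonal x′ y x′y) y-in-block

  row-is-v : ∀ x₀ → rb x₀ ≡ rb x → ∀ y₀ → cb y₀ ≡ rb x → M x₀ y₀ ≡ true →
             ∀ y₁ → cb y₁ ≡ rb x → M x₀ y₁ ≡ v y₁
  row-is-v x₀ x₀-in-block y₀ y₀-in-block x₀y₀ with proj₂ (rank≤1 (rb x)) x₀ x₀-in-block
  ... | inj₁ zero-row = ⊥-elim (not-¬ x₀y₀ (zero-row y₀ y₀-in-block))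
  ... | inj₂ v-row    = v-row

module _ {xs : List A} {ys : List B} (∈xs : ∀ x → x ∈ xs) (∈ys : ∀ y → y ∈ ys)
         {M : A → B → Bool} (rect : RectangularMatrix M) where

  private
    rows-agree : ∀ x x′ y → M x y ≡ true → M x′ y ≡ true → ∀ y′ → M x y′ ≡ M x′ y′
    rows-agree x x′ y xy x′y y′ with M x y′ in xy′ | M x′ y′ in x′y′
    ... | true  | true  = refl
    ... | false | false = refl
    ... | true  | false = trans (sym (rect x x′ y y′ xy xy′ x′y)) x′y′
    ... | false | true  = trans (sym xy′) (rect x′ x y y′ x′y x′y′ xy)

    shareColumn : A → A → Bool
    shareColumn x x′ = any (λ y → M x y ∧ M x′ y) ys

    shareColumn-self : ∀ x y → M x y ≡ true → shareColumn x x ≡ true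
    shareColumn-self x y xy = any-∈ _ (∈ys y) (cong₂ _∧_ xy xy)

    -- Block 0 holds the zero rows and columns, block (suc i) the rows
    -- sharing a nonzero column with the i-th element of xs.
    rowBlock : A → Fin (suc (length xs))
    rowBlock x = maybe′ suc zero (findIndexᵇ (shareColumn x) xs)

    colBlock : B → Fin (suc (length xs))
    colBlock y = maybe′ (rowBlock ∘ lookupᴸ xs) zero (findIndexᵇ (λ x → M x y) xs)

    rowBlock-cong : ∀ x x′ → (∀ y → M x y ≡ M x′ y) → rowBlock x ≡ rowBlock x′
    rowBlock-cong x x′ same = cong (maybe′ suc zero)
      (findIndexᵇ-cong (λ x₀ → any-cong (λ y → cong (_∧ M x₀ y) (same y)) ys) xs)

    diagonal : ∀ x y → M x y ≡ true → rowBlock x ≡ colBlock y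
    diagonal x y xy with findIndexᵇ (λ x → M x y) xs in found
    ... | just i  = rowBlock-cong x _ (rows-agree x _ y xy (findIndexᵇ-just _ xs found))
    ... | nothing = ⊥-elim (not-¬ xy (findIndexᵇ-nothing _ xs found (∈xs x)))

    zero-block : ∀ x → rowBlock x ≡ zero → ∀ y → M x y ≡ false
    zero-block x in-block y with findIndexᵇ (shareColumn x) xs in found | M x y in xy
    zero-block x ()       y | just _  | _
    zero-block x in-block y | nothing | false = refl
    zero-block x in-block y | nothing | true  =
      ⊥-elim (not-¬ (shareColumn-self x y xy) (findIndexᵇ-nothing _ xs found (∈xs x)))

    suc-block : ∀ i x → rowBlock x ≡ suc i → ∀ y → M x y ≡ M (lookupᴸ xs i) y
    suc-block i x in-block with findIndexᵇ (shareColumn x) xs in found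
    suc-block i x refl | just .i with any-witness _ ys (findIndexᵇ-just _ xs found)
    ... | y , both = rows-agree x _ y (∧-conicalˡ _ _ both) (∧-conicalʳ _ _ both)

    rank≤1 : (i : Fin (suc (length xs))) → RankAtMost1 M (λ x → rowBlock x ≡ i) (λ y → colBlock y ≡ i)
    rank≤1 zero    = const false       , λ x in-block → inj₁ (λ y _ → zero-block x in-block y)
    rank≤1 (suc i) = M (lookupᴸ xs i) , λ x in-block → inj₂ (λ y _ → suc-block i x in-block y)

  rectangular⇒rankOneBlock : RankOneBlock M
  rectangular⇒rankOneBlock = suc (length xs) , rowBlock , colBlock , diagonal , rank≤1

module _ (S : Structure N) where

  renameAtom : {X Y : Set} → (X → Y) → Atom S X → Atom S Y
  renameAtom ρ (relAtom i vs) = relAtom i (Vec.map ρ vs)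
  renameAtom ρ (eqAtom u v)   = eqAtom (ρ u) (ρ v)

  module _ {n m n′ m′ : ℕ} (ρ : Fin n ⊎ Fin m → Fin n′ ⊎ Fin m′)
           {a : Vec (Fin N) n} {b : Vec (Fin N) m} {a′ : Vec (Fin N) n′} {b′ : Vec (Fin N) m′}
           (ρ-sound : ∀ v → val a′ b′ (ρ v) ≡ val a b v) where

    evalAtom-rename : ∀ at → evalAtom S a′ b′ (renameAtom ρ at) ≡ evalAtom S a b at
    evalAtom-rename (relAtom i vs) = cong (rel S i) (trans (sym (map-∘ (val a′ b′) ρ vs)) (map-cong ρ-sound vs))
    evalAtom-rename (eqAtom u v)   = cong₂ (λ s t → ⌊ s ≟ t ⌋) (ρ-sound u) (ρ-sound v)

    evalConj-rename : ∀ Φ → evalConj S (map (renameAtom ρ) Φ) a′ b′ ≡ evalConj S Φ a b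
    evalConj-rename []       = refl
    evalConj-rename (at ∷ Φ) = cong₂ _∧_ (evalAtom-rename at) (evalConj-rename Φ)

  evalConj-++ : {n m : ℕ} (Φ Ψ : List (Atom S (Fin n ⊎ Fin m))) (a : Vec (Fin N) n) (b : Vec (Fin N) m) →
                evalConj S (Φ ++ᴸ Ψ) a b ≡ evalConj S Φ a b ∧ evalConj S Ψ a b
  evalConj-++ []       Ψ a b = refl
  evalConj-++ (at ∷ Φ) Ψ a b =
    trans (cong (evalAtom S a b at ∧_) (evalConj-++ Φ Ψ a b)) (sym (∧-assoc (evalAtom S a b at) _ _))

  evalQ-∧ʳ : {n n₀ : ℕ} (ks : List ℕ) (Q : Vec (Fin N) (sum ks) → Vec (Fin N) n → Bool)
             (Q₀ : Vec (Fin N) (sum ks) → Vec (Fin N) n₀ → Bool) {a : Vec (Fin N) n} {a₀ : Vec (Fin N) n₀}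
             (c : Bool) → (∀ b → Q b a ≡ Q₀ b a₀ ∧ c) → evalQ S ks Q a ≡ evalQ S ks Q₀ a₀ ∧ c
  evalQ-∧ʳ []       Q Q₀ c Q≡ = Q≡ []
  evalQ-∧ʳ (k ∷ ks) Q Q₀ c Q≡ = trans
    (cong isOdd (count-cong (λ b₁ → evalQ-∧ʳ ks (Q ∘ (b₁ ++_)) (Q₀ ∘ (b₁ ++_)) c (Q≡ ∘ (b₁ ++_)))
                            (allVecs N k)))
    (isOdd-count-∧ʳ _ c (allVecs N k))

  ∃≡2 : {n n′ : ℕ} (m : ℕ) → (Fin n → Fin n′ ⊎ Fin m) → Rel N n → List (Atom S (Fin n′ ⊎ Fin m)) → Rel N n′
  ∃≡2 m σ R E a = isOdd (count (λ b → R (tabulate (val a b ∘ σ)) ∧ evalConj S E a b) (allVecs N m))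

  ∃≡2-zero : {n n′ : ℕ} (σ : Fin n → Fin n′ ⊎ Fin 0) (R : Rel N n) (E : List (Atom S (Fin n′ ⊎ Fin 0)))
             (a : Vec (Fin N) n′) → ∃≡2 0 σ R E a ≡ R (tabulate (val a [] ∘ σ)) ∧ evalConj S E a []
  ∃≡2-zero σ R E a = isOdd-count-allVecs₀ (λ b → R (tabulate (val a b ∘ σ)) ∧ evalConj S E a b)

  ∃≡2-definable : {n n′ : ℕ} (m : ℕ) (σ : Fin n → Fin n′ ⊎ Fin m) (R : Rel N n)
                  (E : List (Atom S (Fin n′ ⊎ Fin m))) → Definable₂ S R → Definable₂ S (∃≡2 m σ R E)
  -- The m new bound variables form the outermost quantifier block.
  ∃≡2-definable {n} {n′} m σ R E (ks , Φ , R≡) = m ∷ ks , Φ′ , defines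
    where
    τ : Fin n′ ⊎ Fin m → Fin n′ ⊎ Fin (m + sum ks)
    τ = map₂ (_↑ˡ sum ks)

    ρ : Fin n ⊎ Fin (sum ks) → Fin n′ ⊎ Fin (m + sum ks)
    ρ = [ τ ∘ σ , inj₂ ∘ (m ↑ʳ_) ]′

    Φ′ : List (Atom S (Fin n′ ⊎ Fin (m + sum ks)))
    Φ′ = map (renameAtom ρ) Φ ++ᴸ map (renameAtom τ) E

    τ-sound : ∀ a b₁ (b : Vec (Fin N) (sum ks)) v → val a (b₁ ++ b) (τ v) ≡ val a b₁ v
    τ-sound a b₁ b (inj₁ x) = refl
    τ-sound a b₁ b (inj₂ y) = lookup-++ˡ b₁ b y

    ρ-sound : ∀ a b₁ b v → val a (b₁ ++ b) (ρ v) ≡ val (tabulate (val a b₁ ∘ σ)) b v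
    ρ-sound a b₁ b (inj₁ j) = trans (τ-sound a b₁ b (σ j)) (sym (lookup∘tabulate _ j))
    ρ-sound a b₁ b (inj₂ s) = lookup-++ʳ b₁ b s

    Φ′-sound : ∀ a b₁ b →
               evalConj S Φ′ a (b₁ ++ b) ≡ evalConj S Φ (tabulate (val a b₁ ∘ σ)) b ∧ evalConj S E a b₁
    Φ′-sound a b₁ b = trans (evalConj-++ (map (renameAtom ρ) Φ) (map (renameAtom τ) E) a (b₁ ++ b))
      (cong₂ _∧_ (evalConj-rename ρ (ρ-sound a b₁ b) Φ) (evalConj-rename τ (τ-sound a b₁ b) E))

    defines : ∀ a → ∃≡2 m σ R E a ≡ evalQ S (m ∷ ks) (λ b a → evalConj S Φ′ a b) a
    defines a = cong isOdd (count-cong (λ b₁ → sym (trans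
      (evalQ-∧ʳ ks _ (λ b a → evalConj S Φ a b) (evalConj S E a b₁) (Φ′-sound a b₁))
      (cong (_∧ evalConj S E a b₁) (sym (R≡ _))))) (allVecs N m))

firstBlock : (k : ℕ) → Fin (k + ℓ) → Bool
firstBlock k = [ const true , const false ]′ ∘ splitAt k

merge-firstBlock : (x x′ : Vec (Fin N) k) (y y′ : Vec (Fin N) ℓ) →
                   merge (firstBlock k) (x ++ y) (x′ ++ y′) ≡ x ++ y′
merge-firstBlock {k = k} x x′ y y′ = trans (tabulate-cong pick) (tabulate∘lookup (x ++ y′))
  where
  pick : ∀ j → (if firstBlock k j then lookup (x ++ y) j else lookup (x′ ++ y′) j) ≡ lookup (x ++ y′) j
  pick j rewrite lookup-splitAt k x y j | lookup-splitAt k x′ y′ j | lookup-splitAt k x y′ j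
    with splitAt k j
  ... | inj₁ i = refl
  ... | inj₂ i = refl

rectangular-++ : {R : Rel N (suc k + suc ℓ)} → Rectangular R →
                 RectangularMatrix (λ (x : Vec (Fin N) (suc k)) (y : Vec (Fin N) (suc ℓ)) → R (x ++ y))
rectangular-++ {k = k} {ℓ} {R} rect x x′ y y′ xy xy′ x′y =
  trans (sym (R-merge x′ x y y′))
        (rect I (zero , refl) (suc k ↑ʳ zero , I-misses) (x ++ y) (x′ ++ y) (x ++ y) (x ++ y′)
              (trans (R-merge x x y y) xy) (trans (R-merge x x y y′) xy′) (trans (R-merge x′ x y y) x′y))
  where
  I : Fin (suc k + suc ℓ) → Bool
  I = firstBlock (suc k)

  I-misses : I (suc k ↑ʳ zero) ≡ false
  I-misses = cong [ const true , const false ]′ (splitAt-↑ʳ (suc k) (suc ℓ) zero)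

  R-merge : ∀ x₁ x₂ y₁ y₂ → R (merge I (x₁ ++ y₁) (x₂ ++ y₂)) ≡ R (x₁ ++ y₂)
  R-merge x₁ x₂ y₁ y₂ = cong R (merge-firstBlock x₁ x₂ y₁ y₂)

reassociate : (k ℓ m : ℕ) → Fin (k + (ℓ + m)) → Fin (k + ℓ) ⊎ Fin m
reassociate k ℓ m = [ inj₁ ∘ (_↑ˡ ℓ) , [ inj₁ ∘ (k ↑ʳ_) , inj₂ ]′ ∘ splitAt ℓ ]′ ∘ splitAt k

tabulate-reassociate : (x : Vec (Fin N) k) (y : Vec (Fin N) ℓ) (z : Vec (Fin N) m) →
                       tabulate (val (x ++ y) z ∘ reassociate k ℓ m) ≡ x ++ (y ++ z)
tabulate-reassociate {k = k} {ℓ} x y z = trans (tabulate-cong pick) (tabulate∘lookup (x ++ (y ++ z)))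
  where
  pick : ∀ j → val (x ++ y) z (reassociate k ℓ _ j) ≡ lookup (x ++ (y ++ z)) j
  pick j rewrite lookup-splitAt k x (y ++ z) j with splitAt k j
  ... | inj₁ i = lookup-++ˡ x y i
  ... | inj₂ j′ rewrite lookup-splitAt ℓ y z j′ with splitAt ℓ j′
  ...   | inj₁ i = lookup-++ʳ x y i
  ...   | inj₂ i = refl

-- the variables of  R (merge I x y)  among the free variables  x ++ y ++ [ z ]
mergeVars : {n : ℕ} → (Fin n → Bool) → Fin n → Fin (n + (n + 1)) ⊎ Fin 0
mergeVars {n} I j = inj₁ (if I j then j ↑ˡ (n + 1) else n ↑ʳ (j ↑ˡ 1))

tabulate-mergeVars : {n : ℕ} (I : Fin n → Bool) (x y : Vec (Fin N) n) (z : Fin N) →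
                     tabulate (val (x ++ (y ++ [ z ])) [] ∘ mergeVars I) ≡ merge I x y
tabulate-mergeVars {n = n} I x y z = tabulate-cong (λ j → pick (I j) j)
  where
  pick : ∀ b j → lookup (x ++ (y ++ [ z ])) (if b then j ↑ˡ (n + 1) else n ↑ʳ (j ↑ˡ 1)) ≡
                 (if b then lookup x j else lookup y j)
  pick true  j = lookup-++ˡ x (y ++ [ z ]) j
  pick false j = trans (lookup-++ʳ x (y ++ [ z ]) (j ↑ˡ 1)) (lookup-++ˡ y [ z ] j)

module _ (S : Structure N) where

  rectangular⇒balanced : StronglyRectangular₂ S → StronglyBalanced₂ S
  rectangular⇒balanced rect n _ R R-def (suc k) (suc ℓ) m (s≤s z≤n) (s≤s z≤n) _ refl =
    rectangular⇒rankOneBlock (∈-allVecs N _) (∈-allVecs N _) (RectangularMatrix-cong parity≡ R″-rectangular)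
    where
    σ : Fin (suc k + (suc ℓ + m)) → Fin (suc k + suc ℓ) ⊎ Fin m
    σ = reassociate (suc k) (suc ℓ) m

    R″ : Rel N (suc k + suc ℓ)
    R″ = ∃≡2 S m σ R []

    2≤ : 2 ≤ suc k + suc ℓ
    2≤ = s≤s (≤-trans (s≤s z≤n) (m≤n+m (suc ℓ) k))

    R″-rectangular : RectangularMatrix (λ x y → R″ (x ++ y))
    R″-rectangular = rectangular-++ {R = R″} (rect _ 2≤ R″ (∃≡2-definable S m σ R [] R-def))

    parity≡ : ∀ x y → R″ (x ++ y) ≡ isOdd (count (λ z → R (x ++ (y ++ z))) (allVecs N m))
    parity≡ x y = cong isOdd
      (count-cong (λ z → trans (∧-identityʳ _) (cong R (tabulate-reassociate x y z))) (allVecs N m))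

  -- the atom  z = x_j  over the free variables  x ++ y ++ [ z ]
  pin : {n : ℕ} → Fin n → List (Atom S (Fin (n + (n + 1)) ⊎ Fin 0))
  pin {n} j = eqAtom (inj₁ (n ↑ʳ (n ↑ʳ zero))) (inj₁ (j ↑ˡ (n + 1))) ∷ []

  ∃≡2-pin : {n : ℕ} (R : Rel N n) (I : Fin n → Bool) (j : Fin n) (x y : Vec (Fin N) n) (z : Fin N) →
            ∃≡2 S 0 (mergeVars I) R (pin j) (x ++ (y ++ [ z ])) ≡ ⌊ z ≟ lookup x j ⌋ ∧ R (merge I x y)
  ∃≡2-pin {n} R I j x y z = begin
    ∃≡2 S 0 (mergeVars I) R (pin j) a
      ≡⟨ ∃≡2-zero S (mergeVars I) R (pin j) a ⟩
    R (tabulate (val a [] ∘ mergeVars I)) ∧ (⌊ lookup a (n ↑ʳ (n ↑ʳ zero)) ≟ lookup a (j ↑ˡ (n + 1)) ⌋ ∧ true)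
      ≡⟨ cong₂ _∧_ (cong R (tabulate-mergeVars I x y z)) (∧-identityʳ _) ⟩
    R (merge I x y) ∧ ⌊ lookup a (n ↑ʳ (n ↑ʳ zero)) ≟ lookup a (j ↑ˡ (n + 1)) ⌋
      ≡⟨ cong₂ (λ s t → R (merge I x y) ∧ ⌊ s ≟ t ⌋)
               (trans (lookup-++ʳ x (y ++ [ z ]) (n ↑ʳ zero)) (lookup-++ʳ y [ z ] zero))
               (lookup-++ˡ x (y ++ [ z ]) j) ⟩
    R (merge I x y) ∧ ⌊ z ≟ lookup x j ⌋
      ≡⟨ ∧-comm (R (merge I x y)) _ ⟩
    ⌊ z ≟ lookup x j ⌋ ∧ R (merge I x y)
      ∎
    where
    open ≡-Reasoning
    a = x ++ (y ++ [ z ])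

  balanced⇒rectangular : StronglyBalanced₂ S → StronglyRectangular₂ S
  balanced⇒rectangular balanced n 2≤n R R-def I (j , _) _ =
    RectangularMatrix-cong parity≡ (rankOneBlock⇒rectangular parity R′-balanced)
    where
    R′ : Rel N (n + (n + 1))
    R′ = ∃≡2 S 0 (mergeVars I) R (pin j)

    parity : Vec (Fin N) n → Vec (Fin N) n → Bool
    parity x y = isOdd (count (λ z → R′ (x ++ (y ++ z))) (allVecs N 1))

    1≤n : 1 ≤ n
    1≤n = ≤-trans (s≤s z≤n) 2≤n

    R′-balanced : RankOneBlock parity
    R′-balanced = balanced _ (+-mono-≤ 2≤n (m≤n+m 1 n)) R′ (∃≡2-definable S 0 (mergeVars I) R (pin j) R-def)
                           n n 1 1≤n 1≤n (s≤s z≤n) refl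

    parity≡ : ∀ x y → parity x y ≡ R (merge I x y)
    parity≡ x y = begin
      isOdd (count (λ z → R′ (x ++ (y ++ z))) (allVecs N 1))
        ≡⟨ cong isOdd (count-allVecs₁ {N} _) ⟩
      isOdd (count (λ z → R′ (x ++ (y ++ [ z ]))) (allFin N))
        ≡⟨ cong isOdd (count-cong (∃≡2-pin R I j x y) (allFin N)) ⟩
      isOdd (count (λ z → ⌊ z ≟ lookup x j ⌋ ∧ R (merge I x y)) (allFin N))
        ≡⟨ isOdd-count-∧ʳ _ _ (allFin N) ⟩
      isOdd (count (λ z → ⌊ z ≟ lookup x j ⌋) (allFin N)) ∧ R (merge I x y)
        ≡⟨ cong (λ c → isOdd c ∧ R (merge I x y)) (count-≟-allFin (lookup x j)) ⟩
      R (merge I x y)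
        ∎
      where open ≡-Reasoning

lemma6p4 : (N : ℕ) (S : Structure N) →
    (StronglyRectangular₂ S → StronglyBalanced₂ S) ×
    (StronglyBalanced₂ S → StronglyRectangular₂ S)
lemma6p4 N S = rectangular⇒balanced S , balanced⇒rectangular S
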